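{- Let $M$ be a term of $\lambda^{Sym}_{Prop}$ and $\Gamma$ a context. (1) If $\Gamma\vdash M:A$ with $A\neq\bot$, then $\Gamma^{\mathfrak f}\rhd M^{\mathfrak f}:A^{\mathfrak f}\mid$ (with empty $r$-context) in $\overline{\lambda}\mu\tilde{\mu}^*$. (2) If $\Gamma\vdash M:\bot$, then $M^{\mathfrak f}:(\Gamma^{\mathfrak f}\rhd\ )$ (with empty $r$-context).
   Context: $\lambda^{Sym}_{Prop}$: m-types $A::=\alpha\mid\alpha^\bot\mid A\wedge A\mid A\vee A$ over atomic types $\alpha$, types m-types or $\bot$, involutive negation $(\alpha)^\bot=\alpha^\bot$, $(\alpha^\bot)^\bot=\alpha$, $(A\wedge B)^\bot=A^\bot\vee B^\bot$, $(A\vee B)^\bot=A^\bot\wedge B^\bot$; typing $\Gamma,x:A\vdash x:A$; $\langle P_1,P_2\rangle:A_1\wedge A_2$; $\sigma_i(P_i):A_1\vee A_2$ from $P_i:A_i$; $\lambda xP:A^\bot$ from $\Gamma,x:A\vdash P:\bot$; $(P_1\star P_2):\bot$ from $P_1:A^\bot,P_2:A$. $\overline{\lambda}\mu\tilde{\mu}^*$ (same atomic types, its variables of $\lambda^{Sym}_{Prop}$ used as $l$-variables): $p::=\lfloor t,e\rfloor$; $t::=x\mid\lambda x\,t\mid\mu\alpha\,p\mid\overline{e}$; $e::=\alpha\mid(t.e)\mid\tilde{\mu}x\,p\mid\widetilde{t}$; types from atomic types by $A\to B$ and $A^\bot$ modulo $(A^\bot)^\bot=A$; typing: $\Gamma,x:A\rhd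 x:A\mid\Delta$; $\Gamma\mid\alpha:A\rhd\alpha:A,\Delta$; $\lambda x\,t:A\to B$ from $\Gamma,x:A\rhd t:B\mid\Delta$; $(t.e):A\to B$ from $t:A$, $e:B$; $\lfloor t,e\rfloor:(\Gamma\rhd\Delta)$ from $\Gamma\rhd t:A\mid\Delta$, $\Gamma\mid e:A\rhd\Delta$; $\Gamma\rhd\mu\alpha\,p:A\mid\Delta$ from $p:(\Gamma\rhd\alpha:A,\Delta)$; $\Gamma\mid\tilde\mu x\,p:A\rhd\Delta$ from $p:(\Gamma,x:A\rhd\Delta)$; $\overline e:A^\bot$ from $e:A$; $\widetilde t:A^\bot$ from $t:A$. Translation $\cdot^{\mathfrak f}$: $x^{\mathfrak f}=x$; $(P\star Q)^{\mathfrak f}=\lfloor Q^{\mathfrak f},\widetilde{P^{\mathfrak f}}\rfloor$; $(\lambda xN)^{\mathfrak f}=\overline{\tilde\mu x\,N^{\mathfrak f}}$; $\langle P,Q\rangle^{\mathfrak f}=\overline{(P^{\mathfrak f}.\widetilde{Q^{\mathfrak f}})}$; $\sigma_1(N)^{\mathfrak f}=\lambda x\,\mu\beta\lfloor N^{\mathfrak f},\widetilde{x}\rfloor$ with $x,\beta$ fresh; $\sigma_2(N)^{\mathfrak f}=\lambda x\,N^{\mathfrak f}$ with $x$ fresh. On types: $\alpha^{\mathfrak f}=\alpha$, $(\alpha^\bot)^{\mathfrak f}=\alpha^\bot$, $(A\wedge B)^{\mathfrak f}=(A^{\mathfrak f}\to(B^{\mathfrak f})^\bot)^\bot$, $(A\vee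 B)^{\mathfrak f}=(A^{\mathfrak f})^\bot\to B^{\mathfrak f}$. $\Gamma^{\mathfrak f}=\{x:A^{\mathfrak f}\mid x:A\in\Gamma\}$. -}

module Defs where

open import Data.Nat using (ℕ; suc; _⊔_)
open import Data.Product using (_×_; _,_)
open import Data.List using (List; []; _∷_; map)
open import Data.Maybe using (Maybe; just; nothing)
open import Relation.Binary.PropositionalEquality using (_≡_)
open import Relation.Nullary using (¬_)

Atom : Set
Atom = ℕ

-- l-variables (shared by λSym and λ̄μμ̃*) and co-variables (r-variables)
Var : Set
Var = ℕ

CoVar : Set
CoVar = ℕ

data _∋_∶_ {A : Set} : List (Var × A) → Var → A → Set where
  here  : ∀ {Γ x a} → ((x , a) ∷ Γ) ∋ x ∶ a
  there : ∀ {Γ x y a b} → ¬ (x ≡ y) → Γ ∋ x ∶ a → ((y , b) ∷ Γ) ∋ x ∶ a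

data MType : Set where
  atom  : Atom → MType
  atom⊥ : Atom → MType
  _∧_   : MType → MType → MType
  _∨_   : MType → MType → MType

_⊥ : MType → MType
atom a ⊥ = atom⊥ a
atom⊥ a ⊥ = atom a
(A ∧ B) ⊥ = (A ⊥) ∨ (B ⊥)
(A ∨ B) ⊥ = (A ⊥) ∧ (B ⊥)

data SType : Set where
  m   : MType → SType
  bot : SType

data STerm : Set where
  var  : Var → STerm
  ⟨_,_⟩ : STerm → STerm → STerm
  σ₁   : STerm → STerm
  σ₂   : STerm → STerm
  lam  : Var → STerm → STerm
  _⋆_  : STerm → STerm → STerm

SCtx : Set
SCtx = List (Var × MType)

data _⊢_∶_ : SCtx → STerm → SType → Set where
  ax   : ∀ {Γ x A} → Γ ∋ x ∶ A → Γ ⊢ var x ∶ m A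
  pair : ∀ {Γ P₁ P₂ A₁ A₂} → Γ ⊢ P₁ ∶ m A₁ → Γ ⊢ P₂ ∶ m A₂ → Γ ⊢ ⟨ P₁ , P₂ ⟩ ∶ m (A₁ ∧ A₂)
  inj₁ : ∀ {Γ P A₁ A₂} → Γ ⊢ P ∶ m A₁ → Γ ⊢ σ₁ P ∶ m (A₁ ∨ A₂)
  inj₂ : ∀ {Γ P A₁ A₂} → Γ ⊢ P ∶ m A₂ → Γ ⊢ σ₂ P ∶ m (A₁ ∨ A₂)
  abs  : ∀ {Γ x A P} → ((x , A) ∷ Γ) ⊢ P ∶ bot → Γ ⊢ lam x P ∶ m (A ⊥)
  cut  : ∀ {Γ P₁ P₂ A} → Γ ⊢ P₁ ∶ m (A ⊥) → Γ ⊢ P₂ ∶ m A → Γ ⊢ (P₁ ⋆ P₂) ∶ bot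

-- λ̄μμ̃*
-- Types modulo (A^⊥)^⊥ = A, represented by canonical forms:
-- a type is a "positive" type (atom or arrow) possibly under one negation.

data Ty : Set
data PTy : Set where
  atom : Atom → PTy
  _⇒_  : Ty → Ty → PTy
data Ty where
  pos : PTy → Ty
  neg : PTy → Ty

_ᗮ : Ty → Ty
pos p ᗮ = neg p
neg p ᗮ = pos p

data Cmd : Set
data Tm : Set
data Ctx : Set

data Cmd where
  ⌊_,_⌋ : Tm → Ctx → Cmd

data Tm where
  v    : Var → Tm
  lamT : Var → Tm → Tm
  μ    : CoVar → Cmd → Tm
  bar  : Ctx → Tm

data Ctx where
  co    : CoVar → Ctx
  _·_   : Tm → Ctx → Ctx
  μ̃     : Var → Cmd → Ctx
  tilde : Tm → Ctx

LCtx : Set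
LCtx = List (Var × Ty)

RCtx : Set
RCtx = List (CoVar × Ty)

data _▷_∶_∣_ : LCtx → Tm → Ty → RCtx → Set
data _∣_∶_▷_ : LCtx → Ctx → Ty → RCtx → Set
data _∶[_▷_] : Cmd → LCtx → RCtx → Set

data _▷_∶_∣_ where
  axL  : ∀ {Γ Δ x A} → Γ ∋ x ∶ A → Γ ▷ v x ∶ A ∣ Δ
  absI : ∀ {Γ Δ x t A B} → ((x , A) ∷ Γ) ▷ t ∶ B ∣ Δ → Γ ▷ lamT x t ∶ pos (A ⇒ B) ∣ Δ
  μI   : ∀ {Γ Δ α p A} → p ∶[ Γ ▷ ((α , A) ∷ Δ) ] → Γ ▷ μ α p ∶ A ∣ Δ
  barI : ∀ {Γ Δ e A} → Γ ∣ e ∶ A ▷ Δ → Γ ▷ bar e ∶ A ᗮ ∣ Δ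

data _∣_∶_▷_ where
  axR    : ∀ {Γ Δ α A} → Δ ∋ α ∶ A → Γ ∣ co α ∶ A ▷ Δ
  appI   : ∀ {Γ Δ t e A B} → Γ ▷ t ∶ A ∣ Δ → Γ ∣ e ∶ B ▷ Δ → Γ ∣ t · e ∶ pos (A ⇒ B) ▷ Δ
  μ̃I     : ∀ {Γ Δ x p A} → p ∶[ ((x , A) ∷ Γ) ▷ Δ ] → Γ ∣ μ̃ x p ∶ A ▷ Δ
  tildeI : ∀ {Γ Δ t A} → Γ ▷ t ∶ A ∣ Δ → Γ ∣ tilde t ∶ A ᗮ ▷ Δ

data _∶[_▷_] where
  cutI : ∀ {Γ Δ t e A} → Γ ▷ t ∶ A ∣ Δ → Γ ∣ e ∶ A ▷ Δ → ⌊ t , e ⌋ ∶[ Γ ▷ Δ ]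

-- fresh-variable choice: one more than the largest variable occurring

maxLTm : Tm → ℕ
maxLCtx : Ctx → ℕ
maxLCmd : Cmd → ℕ
maxLTm (v x) = x
maxLTm (lamT x t) = x ⊔ maxLTm t
maxLTm (μ α p) = maxLCmd p
maxLTm (bar e) = maxLCtx e
maxLCtx (co α) = 0
maxLCtx (t · e) = maxLTm t ⊔ maxLCtx e
maxLCtx (μ̃ x p) = x ⊔ maxLCmd p
maxLCtx (tilde t) = maxLTm t
maxLCmd ⌊ t , e ⌋ = maxLTm t ⊔ maxLCtx e

maxCoTm : Tm → ℕ
maxCoCtx : Ctx → ℕ
maxCoCmd : Cmd → ℕ
maxCoTm (v x) = 0
maxCoTm (lamT x t) = maxCoTm t
maxCoTm (μ α p) = α ⊔ maxCoCmd p
maxCoTm (bar e) = maxCoCtx e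
maxCoCtx (co α) = α
maxCoCtx (t · e) = maxCoTm t ⊔ maxCoCtx e
maxCoCtx (μ̃ x p) = maxCoCmd p
maxCoCtx (tilde t) = maxCoTm t
maxCoCmd ⌊ t , e ⌋ = maxCoTm t ⊔ maxCoCtx e

freshL : Tm → Var
freshL t = suc (maxLTm t)

freshCo : Tm → CoVar
freshCo t = suc (maxCoTm t)

-- Translation ·^f.  Terms of type ⊥ go to commands, others to terms;
-- on ill-sorted raw terms the translation is undefined (nothing).

data Tr : Set where
  tm : Tm → Tr
  cm : Cmd → Tr

trStar : Maybe Tr → Maybe Tr → Maybe Tr
trStar (just (tm p)) (just (tm q)) = just (cm ⌊ q , tilde p ⌋)
trStar _ _ = nothing

trLam : Var → Maybe Tr → Maybe Tr
trLam x (just (cm n)) = just (tm (bar (μ̃ x n)))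
trLam x _ = nothing

trPair : Maybe Tr → Maybe Tr → Maybe Tr
trPair (just (tm p)) (just (tm q)) = just (tm (bar (p · tilde q)))
trPair _ _ = nothing

trσ₁ : Maybe Tr → Maybe Tr
trσ₁ (just (tm n)) = just (tm (lamT (freshL n) (μ (freshCo n) ⌊ n , tilde (v (freshL n)) ⌋)))
trσ₁ _ = nothing

trσ₂ : Maybe Tr → Maybe Tr
trσ₂ (just (tm n)) = just (tm (lamT (freshL n) n))
trσ₂ _ = nothing

tr : STerm → Maybe Tr
tr (var x) = just (tm (v x))
tr ⟨ P , Q ⟩ = trPair (tr P) (tr Q)
tr (σ₁ N) = trσ₁ (tr N)
tr (σ₂ N) = trσ₂ (tr N)
tr (lam x N) = trLam x (tr N)
tr (P ⋆ Q) = trStar (tr P) (tr Q)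

trTy : MType → Ty
trTy (atom a) = pos (atom a)
trTy (atom⊥ a) = neg (atom a)
trTy (A ∧ B) = pos (trTy A ⇒ (trTy B ᗮ)) ᗮ
trTy (A ∨ B) = pos ((trTy A ᗮ) ⇒ trTy B)

trCtx : SCtx → LCtx
trCtx = map (λ { (x , A) → (x , trTy A) })

module Submission where

-- The proof is an induction on the typing derivation Γ ⊢ M ∶ S, proving at
-- once that tr M is defined, is a term when S is an m-type and a command when
-- S = ⊥, and is well typed in the translated context with empty r-context.
-- Three kinds of auxiliary facts are needed first:
--   * type bookkeeping: the translation of m-types commutes with the
--     involutive negations, so that the rule for tilde can be used "backwards"
--     (a term of type A^⊥ yields a context of type A);
--   * left weakening by a variable larger than every variable of the term,
--     needed because σ₁ and σ₂ bind a fresh variable freshL n around n;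
--   * right weakening, needed because σ₁ binds a fresh co-variable around n.

open import Defs
open import Data.Product using (Σ; _×_; _,_)
open import Data.List using (List; []; _∷_; _++_)
open import Data.Maybe using (just)
open import Data.Nat using (_<_)
open import Data.Nat.Properties using (<⇒≢; m⊔n<o⇒m<o; m⊔n<o⇒n<o; n<1+n)
open import Relation.Binary.PropositionalEquality using (_≡_; refl; subst)
open import Relation.Nullary using (¬_)

ᗮ-involutive : ∀ T → (T ᗮ) ᗮ ≡ T
ᗮ-involutive (pos p) = refl
ᗮ-involutive (neg p) = refl

trTy-⊥ : ∀ A → trTy (A ⊥) ≡ trTy A ᗮ
trTy-⊥ (atom a)  = refl
trTy-⊥ (atom⊥ a) = refl
trTy-⊥ (A ∧ B) rewrite trTy-⊥ A | trTy-⊥ B | ᗮ-involutive (trTy A) = refl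
trTy-⊥ (A ∨ B) rewrite trTy-⊥ A | trTy-⊥ B | ᗮ-involutive (trTy B) = refl

tildeI-ᗮ : ∀ {Γ Δ t T} → Γ ▷ t ∶ T ᗮ ∣ Δ → Γ ∣ tilde t ∶ T ▷ Δ
tildeI-ᗮ {Γ} {Δ} {t} {T} d =
  subst (λ U → Γ ∣ tilde t ∶ U ▷ Δ) (ᗮ-involutive T) (tildeI d)

trCtx-∋ : ∀ {Γ x A} → Γ ∋ x ∶ A → trCtx Γ ∋ x ∶ trTy A
trCtx-∋ here         = here
trCtx-∋ (there ne d) = there ne (trCtx-∋ d)

∋-insert : ∀ {T : Set} (Γ₁ : List (Var × T)) {Γ₂ y x A B} → ¬ (y ≡ x) →
           (Γ₁ ++ Γ₂) ∋ y ∶ A → (Γ₁ ++ ((x , B) ∷ Γ₂)) ∋ y ∶ A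
∋-insert []       y≢x d           = there y≢x d
∋-insert (_ ∷ Γ₁) y≢x here        = here
∋-insert (_ ∷ Γ₁) y≢x (there n d) = there n (∋-insert Γ₁ y≢x d)

∋-append : ∀ {T : Set} (Δ Δ' : List (Var × T)) {y A} → Δ ∋ y ∶ A → (Δ ++ Δ') ∋ y ∶ A
∋-append (_ ∷ Δ) Δ' here        = here
∋-append (_ ∷ Δ) Δ' (there n d) = there n (∋-append Δ Δ' d)

-- The prefix Γ₁ accounts for the binders traversed by the induction.
weakenL-Tm  : ∀ Γ₁ {Γ₂ Δ t A x B} → maxLTm t < x →
              (Γ₁ ++ Γ₂) ▷ t ∶ A ∣ Δ → (Γ₁ ++ ((x , B) ∷ Γ₂)) ▷ t ∶ A ∣ Δ
weakenL-Ctx : ∀ Γ₁ {Γ₂ Δ e A x B} → maxLCtx e < x →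
              (Γ₁ ++ Γ₂) ∣ e ∶ A ▷ Δ → (Γ₁ ++ ((x , B) ∷ Γ₂)) ∣ e ∶ A ▷ Δ
weakenL-Cmd : ∀ Γ₁ {Γ₂ Δ p x B} → maxLCmd p < x →
              p ∶[ Γ₁ ++ Γ₂ ▷ Δ ] → p ∶[ Γ₁ ++ ((x , B) ∷ Γ₂) ▷ Δ ]
weakenL-Tm Γ₁ lt (axL d) = axL (∋-insert Γ₁ (<⇒≢ lt) d)
weakenL-Tm Γ₁ {t = lamT y t} lt (absI d) =
  absI (weakenL-Tm (_ ∷ Γ₁) (m⊔n<o⇒n<o y _ lt) d)
weakenL-Tm Γ₁ lt (μI d)   = μI (weakenL-Cmd Γ₁ lt d)
weakenL-Tm Γ₁ lt (barI d) = barI (weakenL-Ctx Γ₁ lt d)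
weakenL-Ctx Γ₁ lt (axR d) = axR d
weakenL-Ctx Γ₁ {e = t · e} lt (appI d d') =
  appI (weakenL-Tm Γ₁ (m⊔n<o⇒m<o _ _ lt) d)
       (weakenL-Ctx Γ₁ (m⊔n<o⇒n<o (maxLTm t) _ lt) d')
weakenL-Ctx Γ₁ {e = μ̃ y p} lt (μ̃I d) =
  μ̃I (weakenL-Cmd (_ ∷ Γ₁) (m⊔n<o⇒n<o y _ lt) d)
weakenL-Ctx Γ₁ lt (tildeI d) = tildeI (weakenL-Tm Γ₁ lt d)
weakenL-Cmd Γ₁ {p = ⌊ t , e ⌋} lt (cutI d d') =
  cutI (weakenL-Tm Γ₁ (m⊔n<o⇒m<o _ _ lt) d)
       (weakenL-Ctx Γ₁ (m⊔n<o⇒n<o (maxLTm t) _ lt) d')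

weakenL-fresh : ∀ {Γ Δ t A B} → Γ ▷ t ∶ A ∣ Δ → ((freshL t , B) ∷ Γ) ▷ t ∶ A ∣ Δ
weakenL-fresh = weakenL-Tm [] (n<1+n _)

weakenR-Tm  : ∀ {Γ Δ t A} Δ' → Γ ▷ t ∶ A ∣ Δ → Γ ▷ t ∶ A ∣ (Δ ++ Δ')
weakenR-Ctx : ∀ {Γ Δ e A} Δ' → Γ ∣ e ∶ A ▷ Δ → Γ ∣ e ∶ A ▷ (Δ ++ Δ')
weakenR-Cmd : ∀ {Γ Δ p} Δ' → p ∶[ Γ ▷ Δ ] → p ∶[ Γ ▷ (Δ ++ Δ') ]
weakenR-Tm Δ' (axL d)   = axL d
weakenR-Tm Δ' (absI d)  = absI (weakenR-Tm Δ' d)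
weakenR-Tm Δ' (μI d)    = μI (weakenR-Cmd Δ' d)
weakenR-Tm Δ' (barI d)  = barI (weakenR-Ctx Δ' d)
weakenR-Ctx {Δ = Δ} Δ' (axR d) = axR (∋-append Δ Δ' d)
weakenR-Ctx Δ' (appI d d')  = appI (weakenR-Tm Δ' d) (weakenR-Ctx Δ' d')
weakenR-Ctx Δ' (μ̃I d)       = μ̃I (weakenR-Cmd Δ' d)
weakenR-Ctx Δ' (tildeI d)   = tildeI (weakenR-Tm Δ' d)
weakenR-Cmd Δ' (cutI d d')  = cutI (weakenR-Tm Δ' d) (weakenR-Ctx Δ' d')

TranslatesAt : STerm → SCtx → SType → Set
TranslatesAt M Γ (m A) = Σ Tm  (λ t → (tr M ≡ just (tm t)) × (trCtx Γ ▷ t ∶ trTy A ∣ []))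
TranslatesAt M Γ bot   = Σ Cmd (λ p → (tr M ≡ just (cm p)) × (p ∶[ trCtx Γ ▷ [] ]))

-- Once the induction hypotheses fix tr of the subterms, the clause of tr
-- computes and only the typing of the produced expression remains.
translate-sound : ∀ {Γ M S} → Γ ⊢ M ∶ S → TranslatesAt M Γ S
translate-sound (ax d) = v _ , refl , axL (trCtx-∋ d)
translate-sound (pair d₁ d₂) with translate-sound d₁ | translate-sound d₂
... | p , eq₁ , ⊢p | q , eq₂ , ⊢q rewrite eq₁ | eq₂ =
  _ , refl , barI (appI ⊢p (tildeI ⊢q))
-- σ₁ N ↦ λx.μβ⌊N^f, x̃⌋: x : A₁^f ᗮ, so x̃ : A₁^f; N^f is weakened on both sides.
translate-sound (inj₁ d) with translate-sound d
... | n , eq , ⊢n rewrite eq =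
  _ , refl , absI (μI (cutI (weakenR-Tm _ (weakenL-fresh ⊢n)) (tildeI-ᗮ (axL here))))
translate-sound (inj₂ d) with translate-sound d
... | n , eq , ⊢n rewrite eq = _ , refl , absI (weakenL-fresh ⊢n)
translate-sound (abs {A = A} d) with translate-sound d
... | p , eq , ⊢p rewrite eq | trTy-⊥ A = _ , refl , barI (μ̃I ⊢p)
translate-sound (cut {A = A} d₁ d₂) with translate-sound d₁ | translate-sound d₂
... | p , eq₁ , ⊢p | q , eq₂ , ⊢q rewrite eq₁ | eq₂ | trTy-⊥ A =
  _ , refl , cutI ⊢q (tildeI-ᗮ ⊢p)

lemma4p9 : (M : STerm) (Γ : SCtx) →
    ((A : MType) → Γ ⊢ M ∶ m A →
      Σ Tm (λ t → (tr M ≡ just (tm t)) × (trCtx Γ ▷ t ∶ trTy A ∣ [])))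
    × (Γ ⊢ M ∶ bot →
      Σ Cmd (λ p → (tr M ≡ just (cm p)) × (p ∶[ trCtx Γ ▷ [] ])))
lemma4p9 M Γ = (λ A → translate-sound) , translate-sound
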